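{- Let $n\ge1$, $0\le m\le n-1$, and let $\tau=b_1\ldots b_n$ be a permutation of size $n$ such that $\tau=T^m(\pi)$ for some permutation $\pi$ of size $n$. Then $\max_{1\le i\le n}|b_i-i|\le n-1-m$.
   Context: Falls of a permutation are its maximal decreasing strings of consecutive entries; the flip $T$ reverses every fall of a permutation in place, and $T^m$ denotes its $m$-fold iterate ($T^0$ is the identity map). The quantity $\max_i|b_i-i|$ is the bandwidth of $\tau$. -}

module Defs where

open import Data.Nat using (ℕ; zero; suc; _<ᵇ_; _⊔_)
open import Data.Nat.Properties using ()
open import Data.List using (List; []; _∷_; _++_; reverse; map; upTo)
open import Data.Bool using (if_then_else_)
open import Data.Product using (_×_; _,_)
open import Data.List.Relation.Binary.Permutation.Propositional using (_↭_)
import Data.Integer as ℤ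

IsPerm : ℕ → List ℕ → Set
IsPerm n τ = τ ↭ map suc (upTo n)

-- Decomposition of a word into its falls: maximal decreasing strings of
-- consecutive entries.  'fallsFrom cur rest' : 'cur' is the (nonempty,
-- decreasing) fall under construction, stored in reading order.
fallsFrom : List ℕ → ℕ → List ℕ → List (List ℕ)
fallsFrom cur last [] = reverse cur ∷ []
fallsFrom cur last (x ∷ xs) =
  if x <ᵇ last
  then fallsFrom (x ∷ cur) x xs
  else reverse cur ∷ fallsFrom (x ∷ []) x xs

falls : List ℕ → List (List ℕ)
falls [] = []
falls (x ∷ xs) = fallsFrom (x ∷ []) x xs

concatL : List (List ℕ) → List ℕ
concatL [] = []
concatL (f ∷ fs) = f ++ concatL fs

T : List ℕ → List ℕ
T π = concatL (map reverse (falls π))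

iterT : ℕ → List ℕ → List ℕ
iterT zero π = π
iterT (suc m) π = T (iterT m π)

dist : ℕ → ℕ → ℕ
dist a b = ℤ.∣ ℤ.+ a ℤ.- ℤ.+ b ∣

bandwidthFrom : ℕ → List ℕ → ℕ
bandwidthFrom i [] = 0
bandwidthFrom i (b ∷ bs) = dist b i ⊔ bandwidthFrom (suc i) bs

bandwidth : List ℕ → ℕ
bandwidth τ = bandwidthFrom 1 τ

-- Fix a threshold k and read a word through it, writing 1 for an entry above
-- k and 0 otherwise.  A fall is decreasing, so it reads 1…10…0, and the flip
-- turns it into 0…01…1; a fall made only of 1s is followed by a 1, by
-- maximality.  Call a binary word m-flipped if every 1 that precedes some 0
-- has at least m zeros before it and ones after it in total.  Every word is
-- 0-flipped, and one flip turns m-flipped words into (m+1)-flipped ones.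
-- In a permutation τ = T^m(π) of size n with b_i = b, the threshold b − 1
-- makes position i a 1 in a word with b − 1 zeros, and the threshold b makes
-- it a 0 in a word with b zeros; counting gives b − i ≤ n − 1 − m and
-- i − b ≤ n − 1 − m.
module Submission where

open import Defs
open import Data.Bool using (Bool; true; false)
open import Data.Empty using (⊥-elim)
open import Data.List using (List; []; _∷_; _++_; _∷ʳ_; reverse; map; upTo; applyUpTo; length; replicate)
open import Data.List.Properties
  using (map-++; map-∘; reverse-map; reverse-++; reverse-involutive; unfold-reverse; ++-assoc; length-map; length-++; length-upTo; map-upTo)
open import Data.List.Relation.Unary.Any using (here)
open import Data.List.Relation.Unary.Linked using (Linked; [-]; _∷_)
open import Data.List.Membership.Propositional.Properties using (∈-map⁻; ∈-++⁺ʳ; ∈-upTo⁻)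
open import Data.List.Relation.Binary.Permutation.Propositional as ↭ using (_↭_)
open import Data.List.Relation.Binary.Permutation.Propositional.Properties
  using (++-comm; ++⁺; ∈-resp-↭; ↭-length; map⁺)
open import Data.Nat using (ℕ; zero; suc; _+_; _∸_; _⊓_; _≤_; _<_; _<ᵇ_; z≤n; s≤s; _<?_)
open import Data.Nat.Properties
open import Data.Nat.Tactic.RingSolver using (solve-∀)
open import Algebra.Properties.CommutativeSemigroup +-commutativeSemigroup using (x∙yz≈y∙xz)
open import Data.Product using (∃₂; _×_; _,_; proj₁; proj₂)
open import Data.Sum using (_⊎_; inj₁; inj₂)
open import Data.Unit using (⊤; tt)
open import Function using (id; _∘_)
open import Relation.Nullary using (¬_; yes; no)
open import Relation.Nullary.Reflects using (ofʸ; ofⁿ)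
open import Relation.Binary.PropositionalEquality
import Data.Integer as ℤ
import Data.Integer.Properties as ℤ

<ᵇ-true : ∀ {m n} → m < n → (m <ᵇ n) ≡ true
<ᵇ-true {m} {n} m<n with m <ᵇ n | <ᵇ-reflects-< m n
... | true  | _        = refl
... | false | ofⁿ m≮n = ⊥-elim (m≮n m<n)

<ᵇ-false : ∀ {m n} → ¬ m < n → (m <ᵇ n) ≡ false
<ᵇ-false {m} {n} m≮n with m <ᵇ n | <ᵇ-reflects-< m n
... | false | _        = refl
... | true  | ofʸ m<n = ⊥-elim (m≮n m<n)

reverse-replicate : ∀ {A : Set} n (x : A) → reverse (replicate n x) ≡ replicate n x
reverse-replicate zero    x = refl
reverse-replicate (suc n) x = begin
  reverse (x ∷ replicate n x)  ≡⟨ unfold-reverse x (replicate n x) ⟩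
  reverse (replicate n x) ∷ʳ x ≡⟨ cong (_∷ʳ x) (reverse-replicate n x) ⟩
  replicate n x ∷ʳ x           ≡⟨ replicate-∷ʳ n ⟩
  x ∷ replicate n x            ∎
  where
  open ≡-Reasoning
  replicate-∷ʳ : ∀ n → replicate n x ∷ʳ x ≡ x ∷ replicate n x
  replicate-∷ʳ zero    = refl
  replicate-∷ʳ (suc n) = cong (x ∷_) (replicate-∷ʳ n)

ones : List Bool → ℕ
ones []          = 0
ones (true  ∷ w) = suc (ones w)
ones (false ∷ w) = ones w

zeros : List Bool → ℕ
zeros []          = 0
zeros (true  ∷ w) = zeros w
zeros (false ∷ w) = suc (zeros w)

ones-++ : ∀ p q → ones (p ++ q) ≡ ones p + ones q
ones-++ []          q = refl
ones-++ (true  ∷ p) q = cong suc (ones-++ p q)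
ones-++ (false ∷ p) q = ones-++ p q

zeros-++ : ∀ p q → zeros (p ++ q) ≡ zeros p + zeros q
zeros-++ []          q = refl
zeros-++ (true  ∷ p) q = zeros-++ p q
zeros-++ (false ∷ p) q = cong suc (zeros-++ p q)

zeros+ones≡length : ∀ w → zeros w + ones w ≡ length w
zeros+ones≡length []          = refl
zeros+ones≡length (true  ∷ w) = trans (+-suc (zeros w) (ones w)) (cong suc (zeros+ones≡length w))
zeros+ones≡length (false ∷ w) = cong suc (zeros+ones≡length w)

zeros≤length : ∀ w → zeros w ≤ length w
zeros≤length w = subst (zeros w ≤_) (zeros+ones≡length w) (m≤m+n (zeros w) (ones w))

ones≤length : ∀ w → ones w ≤ length w
ones≤length w = subst (ones w ≤_) (zeros+ones≡length w) (m≤n+m (ones w) (zeros w))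

ones≡0⇒zeros≡length : ∀ w → ones w ≡ 0 → zeros w ≡ length w
ones≡0⇒zeros≡length w o = begin
  zeros w          ≡⟨ sym (+-identityʳ (zeros w)) ⟩
  zeros w + 0      ≡⟨ cong (zeros w +_) (sym o) ⟩
  zeros w + ones w ≡⟨ zeros+ones≡length w ⟩
  length w         ∎
  where open ≡-Reasoning

zeros-++-false : ∀ p q → suc (zeros p) ≤ zeros (p ++ false ∷ q)
zeros-++-false []          q = s≤s z≤n
zeros-++-false (true  ∷ p) q = zeros-++-false p q
zeros-++-false (false ∷ p) q = s≤s (zeros-++-false p q)

zeros-++-true : ∀ p q → zeros p ≤ zeros (p ++ true ∷ q)
zeros-++-true p q = subst (zeros p ≤_) (sym (zeros-++ p (true ∷ q))) (m≤m+n (zeros p) (zeros q))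

ones-↭ : ∀ {p q} → p ↭ q → ones p ≡ ones q
ones-↭ ↭.refl                    = refl
ones-↭ (↭.prep true  p↭q)        = cong suc (ones-↭ p↭q)
ones-↭ (↭.prep false p↭q)        = ones-↭ p↭q
ones-↭ (↭.swap true  true  p↭q)  = cong (λ o → suc (suc o)) (ones-↭ p↭q)
ones-↭ (↭.swap true  false p↭q)  = cong suc (ones-↭ p↭q)
ones-↭ (↭.swap false true  p↭q)  = cong suc (ones-↭ p↭q)
ones-↭ (↭.swap false false p↭q)  = ones-↭ p↭q
ones-↭ (↭.trans p↭q q↭r)         = trans (ones-↭ p↭q) (ones-↭ q↭r)

zeros-↭ : ∀ {p q} → p ↭ q → zeros p ≡ zeros q
zeros-↭ {p} {q} p↭q = +-cancelʳ-≡ (ones p) (zeros p) (zeros q) (begin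
  zeros p + ones p ≡⟨ zeros+ones≡length p ⟩
  length p         ≡⟨ ↭-length p↭q ⟩
  length q         ≡⟨ sym (zeros+ones≡length q) ⟩
  zeros q + ones q ≡⟨ cong (zeros q +_) (sym (ones-↭ p↭q)) ⟩
  zeros q + ones p ∎)
  where open ≡-Reasoning

ones-trues-++ : ∀ a w → ones (replicate a true ++ w) ≡ a + ones w
ones-trues-++ zero    w = refl
ones-trues-++ (suc a) w = cong suc (ones-trues-++ a w)

zeros-trues-++ : ∀ a w → zeros (replicate a true ++ w) ≡ zeros w
zeros-trues-++ zero    w = refl
zeros-trues-++ (suc a) w = zeros-trues-++ a w

ones-falses-++ : ∀ b w → ones (replicate b false ++ w) ≡ ones w
ones-falses-++ zero    w = refl
ones-falses-++ (suc b) w = ones-falses-++ b w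

-- Flipped m 0 w says that w is m-flipped; z counts the zeros already read.
Flipped : ℕ → ℕ → List Bool → Set
Flipped m z []          = ⊤
Flipped m z (false ∷ w) = Flipped m (suc z) w
Flipped m z (true  ∷ w) = (1 ≤ zeros w → m ≤ z + ones w) × Flipped m z w

Flipped-0 : ∀ z w → Flipped 0 z w
Flipped-0 z []          = tt
Flipped-0 z (false ∷ w) = Flipped-0 (suc z) w
Flipped-0 z (true  ∷ w) = (λ _ → z≤n) , Flipped-0 z w

Flipped-falses-++ : ∀ m b z w → Flipped m z (replicate b false ++ w) ≡ Flipped m (b + z) w
Flipped-falses-++ m zero    z w = refl
Flipped-falses-++ m (suc b) z w =
  trans (Flipped-falses-++ m b (suc z) w) (cong (λ z′ → Flipped m z′ w) (+-suc b z))

Flipped-trues-++⁻ : ∀ m z a w → Flipped m z (replicate a true ++ w) → Flipped m z w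
Flipped-trues-++⁻ m z zero    w fl = fl
Flipped-trues-++⁻ m z (suc a) w fl = Flipped-trues-++⁻ m z a w (proj₂ fl)

Flipped-trues-++⁺ : ∀ m z a w → (1 ≤ zeros w → m ≤ z + ones w) → Flipped m z w →
                    Flipped m z (replicate a true ++ w)
Flipped-trues-++⁺ m z zero    w last fl = fl
Flipped-trues-++⁺ m z (suc a) w last fl = first , Flipped-trues-++⁺ m z a w last fl
  where
  first : 1 ≤ zeros (replicate a true ++ w) → m ≤ z + ones (replicate a true ++ w)
  first h = ≤-trans (last (subst (1 ≤_) (zeros-trues-++ a w) h))
                    (+-monoʳ-≤ z (subst (ones w ≤_) (sym (ones-trues-++ a w)) (m≤n+m (ones w) a)))

Flipped-last-true : ∀ m z a w → Flipped m z (replicate (suc a) true ++ w) →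
                    1 ≤ zeros w → m ≤ z + ones w
Flipped-last-true m z zero    w fl = proj₁ fl
Flipped-last-true m z (suc a) w fl = Flipped-last-true m z a w (proj₂ fl)

Flipped-split : ∀ m z p q → Flipped m z (p ++ true ∷ q) → 1 ≤ zeros q → m ≤ z + zeros p + ones q
Flipped-split m z []          q fl h = subst (λ z′ → m ≤ z′ + ones q) (sym (+-identityʳ z)) (proj₁ fl h)
Flipped-split m z (true  ∷ p) q fl h = Flipped-split m z p q (proj₂ fl) h
Flipped-split m z (false ∷ p) q fl h =
  subst (λ z′ → m ≤ z′ + ones q) (sym (+-suc z (zeros p))) (Flipped-split m (suc z) p q fl h)

data NoLeadingZero : List Bool → Set where
  empty       : NoLeadingZero []
  leading-one : ∀ w → NoLeadingZero (true ∷ w)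

-- Each block is the image of one fall; the side condition records the
-- maximality of a fall made only of 1s.
data FlipStep : List Bool → List Bool → Set where
  []    : FlipStep [] []
  block : ∀ a b {w w′} → (b ≡ 0 → NoLeadingZero w) → FlipStep w w′ →
          FlipStep (replicate a true ++ replicate b false ++ w)
                   (replicate b false ++ replicate a true ++ w′)

FlipStep⇒↭ : ∀ {w w′} → FlipStep w w′ → w ↭ w′
FlipStep⇒↭ [] = ↭.refl
FlipStep⇒↭ (block a b {w} {w′} _ st) = begin
  ones-block ++ zeros-block ++ w    ≡⟨ ++-assoc ones-block zeros-block w ⟨
  (ones-block ++ zeros-block) ++ w  ↭⟨ ++⁺ (++-comm ones-block zeros-block) (FlipStep⇒↭ st) ⟩
  (zeros-block ++ ones-block) ++ w′ ≡⟨ ++-assoc zeros-block ones-block w′ ⟩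
  zeros-block ++ ones-block ++ w′   ∎
  where
  open ↭.PermutationReasoning
  ones-block = replicate a true
  zeros-block = replicate b false

-- The last 1 of a block gains the b zeros of its fall; when b = 0 the first 1
-- of the next fall already had the required count.
last-one-gains : ∀ {m} z b {w w′} → FlipStep w w′ → (b ≡ 0 → NoLeadingZero w) →
                 (1 ≤ zeros (replicate b false ++ w) → m ≤ z + ones (replicate b false ++ w)) →
                 Flipped m (b + z) w → 1 ≤ zeros w′ → suc m ≤ b + z + ones w′
last-one-gains {m} z (suc b) {w} {w′} st _ old _ _ = s≤s (begin
  m                                       ≤⟨ old (s≤s z≤n) ⟩
  z + ones (replicate (suc b) false ++ w) ≡⟨ cong (z +_) (ones-falses-++ (suc b) w) ⟩
  z + ones w                              ≡⟨ cong (z +_) (ones-↭ (FlipStep⇒↭ st)) ⟩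
  z + ones w′                             ≤⟨ +-monoˡ-≤ (ones w′) (m≤n+m z b) ⟩
  b + z + ones w′                         ∎)
  where open ≤-Reasoning
last-one-gains {m} z zero {w′ = w′} st high _ rest h with high refl
... | empty = ⊥-elim (1+n≰n (subst (1 ≤_) (sym (zeros-↭ (FlipStep⇒↭ st))) h))
... | leading-one w₁ = begin
  suc m                ≤⟨ s≤s (proj₁ rest (subst (1 ≤_) (sym (zeros-↭ (FlipStep⇒↭ st))) h)) ⟩
  suc (z + ones w₁)    ≡⟨ +-suc z (ones w₁) ⟨
  z + ones (true ∷ w₁) ≡⟨ cong (z +_) (ones-↭ (FlipStep⇒↭ st)) ⟩
  z + ones w′          ∎
  where open ≤-Reasoning

Flipped-step : ∀ {m w w′} → FlipStep w w′ → ∀ z → Flipped m z w → Flipped (suc m) z w′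
Flipped-step [] z _ = tt
Flipped-step {m} (block a b {w} {w′} high st) z fl =
  subst id (sym (Flipped-falses-++ (suc m) b z _)) (moved a fl)
  where
  rest : Flipped m (b + z) w
  rest = subst id (Flipped-falses-++ m b z w) (Flipped-trues-++⁻ m z a _ fl)
  moved : ∀ a → Flipped m z (replicate a true ++ replicate b false ++ w) →
          Flipped (suc m) (b + z) (replicate a true ++ w′)
  moved zero    _  = Flipped-step st (b + z) rest
  moved (suc a) fl = Flipped-trues-++⁺ (suc m) (b + z) (suc a) w′
    (last-one-gains z b st high (Flipped-last-true m z a _ fl) rest)
    (Flipped-step st (b + z) rest)

threshold : ℕ → List ℕ → List Bool
threshold k = map (k <ᵇ_)

module _ (k : ℕ) where

  threshold-all-above : ∀ {x xs} → Linked _<_ (x ∷ xs) → k < x →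
                        threshold k (x ∷ xs) ≡ replicate (length (x ∷ xs)) true
  threshold-all-above [-]          k<x = cong (_∷ []) (<ᵇ-true k<x)
  threshold-all-above (x<y ∷ y∷ys) k<x =
    cong₂ _∷_ (<ᵇ-true k<x) (threshold-all-above y∷ys (<-trans k<x x<y))

  threshold-increasing : ∀ {x xs} → Linked _<_ (x ∷ xs) → ∃₂ λ a b →
    threshold k (x ∷ xs) ≡ replicate b false ++ replicate a true × (b ≡ 0 → k < x)
  threshold-increasing {x} {xs} inc with k <? x
  ... | yes k<x = length (x ∷ xs) , 0 , threshold-all-above inc k<x , λ _ → k<x
  threshold-increasing {x} {[]} [-] | no k≮x =
    0 , 1 , cong (_∷ []) (<ᵇ-false k≮x) , λ ()
  threshold-increasing {x} {y ∷ ys} (_ ∷ inc) | no k≮x with threshold-increasing inc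
  ... | a , b , eq , _ = a , suc b , cong₂ _∷_ (<ᵇ-false k≮x) eq , λ ()

  -- fallsFrom keeps the fall under construction reversed, hence increasing.
  FlipStep-fall : ∀ {ℓ cs w w′} → Linked _<_ (ℓ ∷ cs) → (k < ℓ → NoLeadingZero (threshold k w)) →
                  FlipStep (threshold k w) (threshold k w′) →
                  FlipStep (threshold k (reverse (ℓ ∷ cs) ++ w))
                           (threshold k (reverse (reverse (ℓ ∷ cs)) ++ w′))
  FlipStep-fall {ℓ} {cs} {w} {w′} inc high st with threshold-increasing inc
  ... | a , b , shape , b≡0⇒k<ℓ =
    subst₂ FlipStep (sym before) (sym after) (block a b (high ∘ b≡0⇒k<ℓ) st)
    where
    open ≡-Reasoning
    c = ℓ ∷ cs
    before : threshold k (reverse c ++ w) ≡ replicate a true ++ replicate b false ++ threshold k w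
    before = begin
      threshold k (reverse c ++ w)                          ≡⟨ map-++ _ (reverse c) w ⟩
      threshold k (reverse c) ++ threshold k w              ≡⟨ cong (_++ threshold k w) (reverse-map _ c) ⟩
      reverse (threshold k c) ++ threshold k w              ≡⟨ cong (λ t → reverse t ++ threshold k w) shape ⟩
      reverse (replicate b false ++ replicate a true) ++ threshold k w
        ≡⟨ cong (_++ threshold k w) (reverse-++ (replicate b false) (replicate a true)) ⟩
      (reverse (replicate a true) ++ reverse (replicate b false)) ++ threshold k w
        ≡⟨ cong₂ (λ p q → (p ++ q) ++ threshold k w) (reverse-replicate a true) (reverse-replicate b false) ⟩
      (replicate a true ++ replicate b false) ++ threshold k w ≡⟨ ++-assoc (replicate a true) _ _ ⟩
      replicate a true ++ replicate b false ++ threshold k w ∎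
    after : threshold k (reverse (reverse c) ++ w′) ≡ replicate b false ++ replicate a true ++ threshold k w′
    after = begin
      threshold k (reverse (reverse c) ++ w′)                 ≡⟨ cong (λ t → threshold k (t ++ w′)) (reverse-involutive c) ⟩
      threshold k (c ++ w′)                                   ≡⟨ map-++ _ c w′ ⟩
      threshold k c ++ threshold k w′                         ≡⟨ cong (_++ threshold k w′) shape ⟩
      (replicate b false ++ replicate a true) ++ threshold k w′ ≡⟨ ++-assoc (replicate b false) _ _ ⟩
      replicate b false ++ replicate a true ++ threshold k w′ ∎

  FlipStep-fallsFrom : ∀ {ℓ cs} xs → Linked _<_ (ℓ ∷ cs) →
    FlipStep (threshold k (reverse (ℓ ∷ cs) ++ xs))
             (threshold k (concatL (map reverse (fallsFrom (ℓ ∷ cs) ℓ xs))))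
  FlipStep-fallsFrom [] inc = FlipStep-fall inc (λ _ → empty) []
  FlipStep-fallsFrom {ℓ} {cs} (x ∷ xs) inc with x <ᵇ ℓ | <ᵇ-reflects-< x ℓ
  ... | true  | ofʸ x<ℓ =
    subst (λ w → FlipStep (threshold k w) (threshold k (concatL (map reverse (fallsFrom (x ∷ ℓ ∷ cs) x xs)))))
          reverse-step (FlipStep-fallsFrom xs (x<ℓ ∷ inc))
    where
    reverse-step : reverse (x ∷ ℓ ∷ cs) ++ xs ≡ reverse (ℓ ∷ cs) ++ x ∷ xs
    reverse-step = trans (cong (_++ xs) (unfold-reverse x (ℓ ∷ cs))) (++-assoc (reverse (ℓ ∷ cs)) (x ∷ []) xs)
  ... | false | ofⁿ x≮ℓ = FlipStep-fall inc next-high (FlipStep-fallsFrom xs [-])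
    where
    next-high : k < ℓ → NoLeadingZero (threshold k (x ∷ xs))
    next-high k<ℓ = subst (λ t → NoLeadingZero (t ∷ threshold k xs))
                          (sym (<ᵇ-true (<-≤-trans k<ℓ (≮⇒≥ x≮ℓ)))) (leading-one _)

  FlipStep-T : ∀ τ → FlipStep (threshold k τ) (threshold k (T τ))
  FlipStep-T []       = []
  FlipStep-T (x ∷ xs) = FlipStep-fallsFrom xs [-]

  Flipped-iterT : ∀ m π → Flipped m 0 (threshold k (iterT m π))
  Flipped-iterT zero    π = Flipped-0 0 (threshold k π)
  Flipped-iterT (suc m) π = Flipped-step (FlipStep-T (iterT m π)) 0 (Flipped-iterT m π)

Flipped-one-bound : ∀ {m D} p q → m + D ≡ length p + length q → Flipped m 0 (p ++ true ∷ q) →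
                    zeros (p ++ true ∷ q) ≤ length p + D
Flipped-one-bound {m} {D} p q len fl with zeros q in zq
... | zero = begin
  zeros (p ++ true ∷ q) ≡⟨ zeros-++ p (true ∷ q) ⟩
  zeros p + zeros q     ≡⟨ cong (zeros p +_) zq ⟩
  zeros p + 0           ≤⟨ +-mono-≤ (zeros≤length p) z≤n ⟩
  length p + D          ∎
  where open ≤-Reasoning
... | suc _ = +-cancelˡ-≤ m _ _ (begin
  m + zeros (p ++ true ∷ q)       ≡⟨ cong (m +_) (zeros-++ p (true ∷ q)) ⟩
  m + (Zp + Zq)                   ≤⟨ +-monoˡ-≤ (Zp + Zq) split ⟩
  (Zp + Oq) + (Zp + Zq)           ≡⟨ shuffle Zp Oq Zq ⟩
  Zp + (Zp + (Zq + Oq))           ≡⟨ cong (λ l → Zp + (Zp + l)) (zeros+ones≡length q) ⟩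
  Zp + (Zp + length q)            ≤⟨ +-mono-≤ (zeros≤length p) (+-monoˡ-≤ (length q) (zeros≤length p)) ⟩
  length p + (length p + length q) ≡⟨ cong (length p +_) len ⟨
  length p + (m + D)              ≡⟨ x∙yz≈y∙xz (length p) m D ⟩
  m + (length p + D)              ∎)
  where
  open ≤-Reasoning
  Zp = zeros p
  Zq = zeros q
  Oq = ones q
  split : m ≤ Zp + Oq
  split = Flipped-split m 0 p q fl (subst (1 ≤_) (sym zq) (s≤s z≤n))
  shuffle : ∀ x y z → (x + y) + (x + z) ≡ x + (x + (z + y))
  shuffle = solve-∀

last-one : ∀ p → ones p ≡ 0 ⊎ ∃₂ λ p₁ p₂ → p ≡ p₁ ++ true ∷ p₂ × ones p₂ ≡ 0
last-one []      = inj₁ refl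
last-one (x ∷ p) with last-one p
... | inj₂ (p₁ , p₂ , refl , o) = inj₂ (x ∷ p₁ , p₂ , refl , o)
last-one (false ∷ p) | inj₁ o = inj₁ o
last-one (true  ∷ p) | inj₁ o = inj₂ ([] , p , refl , o)

Flipped-zero-bound : ∀ {m D} p q → m + D ≡ length p + length q → Flipped m 0 (p ++ false ∷ q) →
                     suc (length p) ≤ zeros (p ++ false ∷ q) + D
Flipped-zero-bound {m} {D} p q len fl with last-one p
... | inj₁ o = begin
  suc (length p)          ≡⟨ cong suc (ones≡0⇒zeros≡length p o) ⟨
  suc (zeros p)           ≤⟨ zeros-++-false p q ⟩
  zeros (p ++ false ∷ q)  ≤⟨ m≤m+n _ D ⟩
  zeros (p ++ false ∷ q) + D ∎
  where open ≤-Reasoning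
... | inj₂ (p₁ , p₂ , refl , o) = +-cancelˡ-≤ m _ _ (begin
  m + suc Lp                  ≤⟨ +-monoˡ-≤ (suc Lp) split ⟩
  (Z₁ + ones q) + suc Lp      ≤⟨ +-monoˡ-≤ (suc Lp) (+-monoʳ-≤ Z₁ (ones≤length q)) ⟩
  (Z₁ + length q) + suc Lp    ≡⟨ shuffle Z₁ (length q) Lp ⟩
  suc Z₁ + (Lp + length q)    ≤⟨ +-mono-≤ Z₁<zeros (≤-reflexive (sym len)) ⟩
  Zw + (m + D)                ≡⟨ x∙yz≈y∙xz Zw m D ⟩
  m + (Zw + D)                ∎)
  where
  open ≤-Reasoning
  w = (p₁ ++ true ∷ p₂) ++ false ∷ q
  Lp = length (p₁ ++ true ∷ p₂)
  Z₁ = zeros p₁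
  Zw = zeros w
  reassociated : w ≡ p₁ ++ true ∷ (p₂ ++ false ∷ q)
  reassociated = ++-assoc p₁ (true ∷ p₂) (false ∷ q)
  split : m ≤ Z₁ + ones q
  split = subst (λ o′ → m ≤ Z₁ + o′) (trans (ones-++ p₂ (false ∷ q)) (cong (_+ ones q) o))
            (Flipped-split m 0 p₁ (p₂ ++ false ∷ q) (subst (Flipped m 0) reassociated fl)
              (≤-trans (s≤s z≤n) (zeros-++-false p₂ q)))
  Z₁<zeros : suc Z₁ ≤ Zw
  Z₁<zeros = ≤-trans (s≤s (zeros-++-true p₁ p₂)) (zeros-++-false (p₁ ++ true ∷ p₂) q)
  shuffle : ∀ x y z → (x + y) + suc z ≡ suc x + (z + y)
  shuffle = solve-∀

threshold-suc : ∀ k xs → threshold (suc k) (map suc xs) ≡ threshold k xs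
threshold-suc k xs = sym (map-∘ xs)

zeros-threshold-0 : ∀ xs → zeros (threshold 0 (map suc xs)) ≡ 0
zeros-threshold-0 []       = refl
zeros-threshold-0 (x ∷ xs) = zeros-threshold-0 xs

zeros-threshold-upTo : ∀ k n → zeros (threshold k (map suc (upTo n))) ≡ k ⊓ n
zeros-threshold-upTo zero    n       = zeros-threshold-0 (upTo n)
zeros-threshold-upTo (suc k) zero    = refl
zeros-threshold-upTo (suc k) (suc n) = cong suc (begin
  zeros (threshold (suc k) (map suc (applyUpTo suc n)))
    ≡⟨ cong (λ xs → zeros (threshold (suc k) (map suc xs))) (map-upTo suc n) ⟨
  zeros (threshold (suc k) (map suc (map suc (upTo n))))
    ≡⟨ cong zeros (threshold-suc k (map suc (upTo n))) ⟩
  zeros (threshold k (map suc (upTo n)))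
    ≡⟨ zeros-threshold-upTo k n ⟩
  k ⊓ n ∎)
  where open ≡-Reasoning

zeros-threshold-perm : ∀ {n τ} k → IsPerm n τ → zeros (threshold k τ) ≡ k ⊓ n
zeros-threshold-perm {n} k perm = trans (zeros-↭ (map⁺ (k <ᵇ_) perm)) (zeros-threshold-upTo k n)

IsPerm⇒length≡ : ∀ {n τ} → IsPerm n τ → length τ ≡ n
IsPerm⇒length≡ {n} perm = trans (↭-length perm) (trans (length-map suc (upTo n)) (length-upTo n))

threshold-++-∷ : ∀ {k b t} u v → (k <ᵇ b) ≡ t → threshold k (u ++ b ∷ v) ≡ threshold k u ++ t ∷ threshold k v
threshold-++-∷ {k} {b} u v k<ᵇb≡t =
  trans (map-++ (k <ᵇ_) u (b ∷ v)) (cong (λ t → threshold k u ++ t ∷ threshold k v) k<ᵇb≡t)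

length-threshold-++ : ∀ {m D} k u v → m + D ≡ length u + length v →
                      m + D ≡ length (threshold k u) + length (threshold k v)
length-threshold-++ k u v len =
  trans len (sym (cong₂ _+_ (length-map (k <ᵇ_) u) (length-map (k <ᵇ_) v)))

threshold-one-bound : ∀ {m D} k u b v → k < b → m + D ≡ length u + length v →
                      Flipped m 0 (threshold k (u ++ b ∷ v)) →
                      zeros (threshold k (u ++ b ∷ v)) ≤ length u + D
threshold-one-bound {m} {D} k u b v k<b len fl = begin
  zeros (threshold k (u ++ b ∷ v))              ≡⟨ cong zeros word ⟩
  zeros (threshold k u ++ true ∷ threshold k v) ≤⟨ Flipped-one-bound (threshold k u) _ len′ (subst (Flipped m 0) word fl) ⟩
  length (threshold k u) + D                    ≡⟨ cong (_+ D) (length-map (k <ᵇ_) u) ⟩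
  length u + D                                  ∎
  where
  open ≤-Reasoning
  word = threshold-++-∷ u v (<ᵇ-true k<b)
  len′ = length-threshold-++ {m} {D} k u v len

threshold-zero-bound : ∀ {m D} k u b v → b ≤ k → m + D ≡ length u + length v →
                       Flipped m 0 (threshold k (u ++ b ∷ v)) →
                       suc (length u) ≤ zeros (threshold k (u ++ b ∷ v)) + D
threshold-zero-bound {m} {D} k u b v b≤k len fl = begin
  suc (length u)                                     ≡⟨ cong suc (length-map (k <ᵇ_) u) ⟨
  suc (length (threshold k u))                       ≤⟨ Flipped-zero-bound (threshold k u) _ len′ (subst (Flipped m 0) word fl) ⟩
  zeros (threshold k u ++ false ∷ threshold k v) + D ≡⟨ cong (λ w → zeros w + D) word ⟨
  zeros (threshold k (u ++ b ∷ v)) + D               ∎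
  where
  open ≤-Reasoning
  word = threshold-++-∷ u v (<ᵇ-false (≤⇒≯ b≤k))
  len′ = length-threshold-++ {m} {D} k u v len

dist-comm : ∀ a c → dist a c ≡ dist c a
dist-comm a c = begin
  ℤ.∣ ℤ.+ a ℤ.- ℤ.+ c ∣ ≡⟨ cong ℤ.∣_∣ (ℤ.m-n≡m⊖n a c) ⟩
  ℤ.∣ a ℤ.⊖ c ∣         ≡⟨ ℤ.∣m⊖n∣≡∣n⊖m∣ a c ⟩
  ℤ.∣ c ℤ.⊖ a ∣         ≡⟨ cong ℤ.∣_∣ (ℤ.m-n≡m⊖n c a) ⟨
  ℤ.∣ ℤ.+ c ℤ.- ℤ.+ a ∣ ∎
  where open ≡-Reasoning

dist≡∸ : ∀ {a c} → c ≤ a → dist a c ≡ a ∸ c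
dist≡∸ {a} {c} c≤a = cong ℤ.∣_∣ (trans (ℤ.m-n≡m⊖n a c) (ℤ.⊖-≥ c≤a))

dist≤ : ∀ {a c d} → a ≤ c + d → c ≤ a + d → dist a c ≤ d
dist≤ {a} {c} {d} a≤c+d c≤a+d with ≤-total c a
... | inj₁ c≤a = subst (_≤ d) (sym (dist≡∸ c≤a)) (m≤n+o⇒m∸n≤o a c a≤c+d)
... | inj₂ a≤c = subst (_≤ d) (sym (trans (dist-comm a c) (dist≡∸ a≤c))) (m≤n+o⇒m∸n≤o c a c≤a+d)

bandwidthFrom≤ : ∀ {d} i w → (∀ u b v → w ≡ u ++ b ∷ v → dist b (i + length u) ≤ d) → bandwidthFrom i w ≤ d
bandwidthFrom≤ i []      _     = z≤n
bandwidthFrom≤ {d} i (b ∷ w) entry = ⊔-lub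
  (subst (λ j → dist b j ≤ d) (+-identityʳ i) (entry [] b w refl))
  (bandwidthFrom≤ (suc i) w λ u c v w≡ →
    subst (λ j → dist c j ≤ d) (+-suc i (length u)) (entry (b ∷ u) c v (cong (b ∷_) w≡)))

entry-bound : ∀ {n m D τ} → suc (m + D) ≡ n → IsPerm n τ → (∀ k → Flipped m 0 (threshold k τ)) →
              ∀ u b v → τ ≡ u ++ b ∷ v → dist b (1 + length u) ≤ D
entry-bound {n} {m} {D} size perm flipped u b v refl
  with ∈-map⁻ suc (∈-resp-↭ perm (∈-++⁺ʳ u (here refl)))
... | i , i∈upTo , refl = dist≤ upper lower
  where
  open ≤-Reasoning
  len : m + D ≡ length u + length v
  len = suc-injective (begin-equality
    suc (m + D)                 ≡⟨ size ⟩
    n                           ≡⟨ IsPerm⇒length≡ perm ⟨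
    length (u ++ suc i ∷ v)     ≡⟨ length-++ u ⟩
    length u + suc (length v)   ≡⟨ +-suc (length u) (length v) ⟩
    suc (length u + length v)   ∎)
  upper : suc i ≤ suc (length u) + D
  upper = s≤s (begin
    i                                      ≡⟨ m≤n⇒m⊓n≡m (<⇒≤ (∈-upTo⁻ i∈upTo)) ⟨
    i ⊓ n                                  ≡⟨ zeros-threshold-perm i perm ⟨
    zeros (threshold i (u ++ suc i ∷ v))   ≤⟨ threshold-one-bound i u (suc i) v ≤-refl len (flipped i) ⟩
    length u + D                           ∎)
  lower : suc (length u) ≤ suc i + D
  lower = begin
    suc (length u)                                 ≤⟨ threshold-zero-bound (suc i) u (suc i) v ≤-refl len (flipped (suc i)) ⟩
    zeros (threshold (suc i) (u ++ suc i ∷ v)) + D ≡⟨ cong (_+ D) (zeros-threshold-perm (suc i) perm) ⟩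
    suc i ⊓ n + D                                  ≤⟨ +-monoˡ-≤ D (m⊓n≤m (suc i) n) ⟩
    suc i + D                                      ∎

theorem21 : (n m : ℕ) → 1 ≤ n → m ≤ n ∸ 1 → (τ π : List ℕ) →
    IsPerm n τ → IsPerm n π → τ ≡ iterT m π →
    bandwidth τ ≤ n ∸ 1 ∸ m
theorem21 (suc n) m _ m≤n τ π τ-perm _ τ≡ = bandwidthFrom≤ 1 τ (entry-bound size τ-perm flipped)
  where
  size : suc (m + (n ∸ m)) ≡ suc n
  size = cong suc (m+[n∸m]≡n m≤n)
  flipped : ∀ k → Flipped m 0 (threshold k τ)
  flipped k = subst (λ t → Flipped m 0 (threshold k t)) (sym τ≡) (Flipped-iterT k m π)
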